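{- For a positive integer $n$, let $z(n)$ be the largest integer with $3z(n)<2n$, let $m(n)$ be the largest integer with $m(n)^2\le 2n$, let $r(n)$ be the least non-negative integer with $n\le 2^{r(n)}$, and put $x(n)=z(n)-(r(n)+1)m(n)$ and $y(n)=2^{2n-2z(n)-m(n)+2}-n^{m(n)-1}$. If $n\ge 1$ is such that $y(n)\le 0$, then $x(n)\le -r(n)-3\le -6$. -}

module Defs where

open import Data.Nat using (ℕ; zero; suc; _+_; _*_; _∸_; _^_; _≤_; _<_)
open import Data.Integer as ℤ using (ℤ; +_)

-- z is the largest integer with 3z < 2n.  (For n ≥ 1 the value is ≥ 0,
-- since 3·0 < 2n, so ranging over ℕ gives the same number.)
IsZ : ℕ → ℕ → Set
IsZ n z = (3 * z < 2 * n) × (∀ w → 3 * w < 2 * n → w ≤ z)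
  where open import Data.Product using (_×_)

-- m is the largest integer with m² ≤ 2n (again ≥ 0 since 0² ≤ 2n).
IsM : ℕ → ℕ → Set
IsM n m = (m * m ≤ 2 * n) × (∀ w → w * w ≤ 2 * n → w ≤ m)
  where open import Data.Product using (_×_)

IsR : ℕ → ℕ → Set
IsR n r = (n ≤ 2 ^ r) × (∀ s → n ≤ 2 ^ s → r ≤ s)
  where open import Data.Product using (_×_)

xval : ℕ → ℕ → ℕ → ℤ
xval z m r = + z ℤ.- (+ (r + 1) ℤ.* + m)

-- y(n) = 2^(2n − 2z − m + 2) − n^(m−1)   (an integer).
-- The exponent 2n+2−2z−m is non-negative whenever z, m are as above
-- (n ≥ 1), and m ≥ 1, so the truncated subtractions ∸ are exact.
yval : ℕ → ℕ → ℕ → ℤ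
yval n z m = + (2 ^ ((2 * n + 2) ∸ (2 * z + m))) ℤ.- + (n ^ (m ∸ 1))

-- y(n) ≤ 0 says 2^E ≤ n^(m−1) with E = 2n + 2 − 2z − m, and n ≤ 2^r turns this into
-- E ≤ r(m−1), i.e. 2n + 2 ≤ 2z + m + r(m−1).  Together with 3z + 1 ≤ 2n this is the bound on x(n).
-- The same inequality fails for every n ≤ 4 (where z, m, r are small), so n ≥ 5 and hence r ≥ 3.
module Submission where

open import Defs
open import Data.Nat using (ℕ; _≥_)
open import Data.Product using (_×_; _,_)

module NatBounds where

  open import Data.Nat
    using (suc; _+_; _*_; _^_; _∸_; _≤_; _<_; _≤ᵇ_; s≤s; z≤n; s<s⁻¹)
  open import Data.Nat.Properties
  open import Data.Nat.Tactic.RingSolver using (solve)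
  open import Data.List using ([]; _∷_)
  open import Data.Bool using (T)
  open import Relation.Nullary using (¬_)
  open ≤-Reasoning

  ^-cancelʳ-≤ : ∀ b {m n} → 1 < b → b ^ m ≤ b ^ n → m ≤ n
  ^-cancelʳ-≤ b 1<b bᵐ≤bⁿ = ≮⇒≥ (λ n<m → <⇒≱ (^-monoʳ-< b 1<b n<m) bᵐ≤bⁿ)

  exponent-bound : ∀ b {a e k r} → 1 < b → b ^ e ≤ a ^ k → a ≤ b ^ r → e ≤ r * k
  exponent-bound b {a} {e} {k} {r} 1<b bᵉ≤aᵏ a≤bʳ = ^-cancelʳ-≤ b 1<b (begin
    b ^ e       ≤⟨ bᵉ≤aᵏ ⟩
    a ^ k       ≤⟨ ^-monoˡ-≤ k a≤bʳ ⟩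
    (b ^ r) ^ k ≡⟨ ^-*-assoc b r k ⟩
    b ^ (r * k) ∎)

  -- Here m = k + 1; a record, so that n, z, k, r can be inferred from a proof of it.
  record ExponentInequality (n z k r : ℕ) : Set where
    constructor exponent-inequality
    field bound : 2 * n + 2 ≤ 2 * z + suc k + r * k
  open ExponentInequality

  2ᴱ≤nᵏ⇒exponent-inequality : ∀ {n z k r} → n ≤ 2 ^ r →
    2 ^ ((2 * n + 2) ∸ (2 * z + suc k)) ≤ n ^ k → ExponentInequality n z k r
  2ᴱ≤nᵏ⇒exponent-inequality {n} {z} {k} {r} n≤2ʳ 2ᴱ≤nᵏ = exponent-inequality (begin
    2 * n + 2         ≤⟨ m≤n+m∸n (2 * n + 2) (2 * z + suc k) ⟩
    2 * z + suc k + E ≤⟨ +-monoʳ-≤ (2 * z + suc k) E≤rk ⟩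
    2 * z + suc k + r * k ∎)
    where
    E = (2 * n + 2) ∸ (2 * z + suc k)
    E≤rk : E ≤ r * k
    E≤rk = exponent-bound 2 {k = k} {r = r} (s≤s (s≤s z≤n)) 2ᴱ≤nᵏ n≤2ʳ

  exponent-inequality⇒x-bound : ∀ {n z k r} → 3 * z < 2 * n →
    ExponentInequality n z k r → z + (r + 3) ≤ (r + 1) * suc k
  exponent-inequality⇒x-bound {n} {z} {k} {r} 3z<2n key = +-cancelˡ-≤ (2 * z) _ _ (begin
    2 * z + (z + (r + 3))       ≡⟨ solve (z ∷ r ∷ []) ⟩
    suc (3 * z) + 2 + r         ≤⟨ +-monoˡ-≤ r (+-monoˡ-≤ 2 3z<2n) ⟩
    2 * n + 2 + r               ≤⟨ +-monoˡ-≤ r (bound key) ⟩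
    2 * z + suc k + r * k + r   ≡⟨ solve (z ∷ k ∷ r ∷ []) ⟩
    2 * z + (r + 1) * suc k     ∎)

  IsM⇒1≤m : ∀ {n m} → 1 ≤ n → IsM n m → 1 ≤ m
  IsM⇒1≤m {n} 1≤n (_ , m-max) = m-max 1 (≤-trans 1≤n (m≤n*m n 2))

  m*m<n*n⇒m<n : ∀ {m n} → m * m < n * n → m < n
  m*m<n*n⇒m<n m*m<n*n = ≰⇒> (λ n≤m → <⇒≱ m*m<n*n (*-mono-≤ n≤m n≤m))

  ≤-by-evaluation : ∀ {a b} {_ : T (a ≤ᵇ b)} → a ≤ b
  ≤-by-evaluation {a} {b} {a≤ᵇb} = ≤ᵇ⇒≤ a b a≤ᵇb

  -- Upper bounds Z, K, R on z, k, r that keep the right-hand side below 2n + 2.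
  exponent-inequality-bounded : ∀ {n z k r} Z K R →
    2 * n ≤ 3 * suc Z → 2 * n < (2 + K) * (2 + K) → n ≤ 2 ^ R → 2 * Z + suc K + R * K < 2 * n + 2 →
    3 * z < 2 * n → suc k * suc k ≤ 2 * n → (∀ s → n ≤ 2 ^ s → r ≤ s) → ¬ ExponentInequality n z k r
  exponent-inequality-bounded {z = z} Z K R 2n≤ 2n< n≤2ᴿ small 3z<2n m²≤2n r-min key =
    <⇒≱ small (≤-trans (bound key) (+-mono-≤ (+-mono-≤ (*-monoʳ-≤ 2 z≤Z) (s≤s k≤K)) (*-mono-≤ r≤R k≤K)))
    where
    z≤Z = ≤-pred (*-cancelˡ-< 3 z (suc Z) (<-≤-trans 3z<2n 2n≤))
    k≤K = ≤-pred (s<s⁻¹ (m*m<n*n⇒m<n (≤-<-trans m²≤2n 2n<)))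
    r≤R = r-min R n≤2ᴿ

  n≤4⇒¬exponent-inequality : ∀ {n z k r} → n ≤ 4 → 3 * z < 2 * n → suc k * suc k ≤ 2 * n →
    (∀ s → n ≤ 2 ^ s → r ≤ s) → ¬ ExponentInequality n z k r
  n≤4⇒¬exponent-inequality {0} _ ()
  n≤4⇒¬exponent-inequality {1} _ = exponent-inequality-bounded 0 0 0
    ≤-by-evaluation ≤-by-evaluation ≤-by-evaluation ≤-by-evaluation
  n≤4⇒¬exponent-inequality {2} _ = exponent-inequality-bounded 1 1 1
    ≤-by-evaluation ≤-by-evaluation ≤-by-evaluation ≤-by-evaluation
  n≤4⇒¬exponent-inequality {3} _ = exponent-inequality-bounded 1 1 2
    ≤-by-evaluation ≤-by-evaluation ≤-by-evaluation ≤-by-evaluation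
  n≤4⇒¬exponent-inequality {4} _ = exponent-inequality-bounded 2 1 2
    ≤-by-evaluation ≤-by-evaluation ≤-by-evaluation ≤-by-evaluation
  n≤4⇒¬exponent-inequality {suc (suc (suc (suc (suc _))))} (s≤s (s≤s (s≤s (s≤s ()))))

  exponent-inequality⇒3≤r : ∀ {n z k r} → 3 * z < 2 * n → suc k * suc k ≤ 2 * n →
    n ≤ 2 ^ r → (∀ s → n ≤ 2 ^ s → r ≤ s) → ExponentInequality n z k r → 3 ≤ r
  exponent-inequality⇒3≤r 3z<2n m²≤2n n≤2ʳ r-min key = ≮⇒≥ λ r<3 →
    n≤4⇒¬exponent-inequality (≤-trans n≤2ʳ (^-monoʳ-≤ 2 (≤-pred r<3))) 3z<2n m²≤2n r-min key

open NatBounds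

open import Data.Integer as ℤ using (+_; -_; _-_; _≤_; +≤+)
import Data.Nat as ℕ
import Data.Nat.Properties as ℕ
open import Data.Integer.Properties
  using (drop‿+≤+; i-j≤0⇒i≤j; neg-mono-≤; neg-distrib-+; +-monoʳ-≤; pos-*; module ≤-Reasoning)
open import Data.Integer.Tactic.RingSolver using (solve-∀)
open import Relation.Binary.PropositionalEquality using (_≡_; sym; cong)

-m-n≡-[m+n] : ∀ m n → - (+ m) - + n ≡ - + (m ℕ.+ n)
-m-n≡-[m+n] m n = sym (neg-distrib-+ (+ m) (+ n))

m+n≤o⇒m-o≤-n : ∀ {m n o} → m ℕ.+ n ℕ.≤ o → + m - + o ≤ - + n
m+n≤o⇒m-o≤-n {m} {n} {o} m+n≤o = begin
  + m - + o             ≤⟨ +-monoʳ-≤ (+ m) (neg-mono-≤ (+≤+ m+n≤o)) ⟩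
  + m - (+ m ℤ.+ + n)   ≡⟨ i-[i+j]≡-j (+ m) (+ n) ⟩
  - + n                 ∎
  where
  open ≤-Reasoning
  i-[i+j]≡-j : ∀ i j → i - (i ℤ.+ j) ≡ - j
  i-[i+j]≡-j = solve-∀

xval-bound : ∀ z m r → z ℕ.+ (r ℕ.+ 3) ℕ.≤ (r ℕ.+ 1) ℕ.* m → xval z m r ≤ - (+ r) - + 3
xval-bound z m r bound = begin
  + z - (+ (r ℕ.+ 1) ℤ.* + m) ≡⟨ cong (λ i → + z - i) (sym (pos-* (r ℕ.+ 1) m)) ⟩
  + z - + ((r ℕ.+ 1) ℕ.* m)   ≤⟨ m+n≤o⇒m-o≤-n bound ⟩
  - + (r ℕ.+ 3)               ≡⟨ sym (-m-n≡-[m+n] r 3) ⟩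
  - (+ r) - + 3               ∎
  where open ≤-Reasoning

3≤r⇒-r-3≤-6 : ∀ {r} → 3 ℕ.≤ r → - (+ r) - + 3 ≤ - (+ 6)
3≤r⇒-r-3≤-6 {r} 3≤r = begin
  - (+ r) - + 3 ≡⟨ -m-n≡-[m+n] r 3 ⟩
  - + (r ℕ.+ 3) ≤⟨ neg-mono-≤ (+≤+ (ℕ.+-monoˡ-≤ 3 3≤r)) ⟩
  - (+ 6)       ∎
  where open ≤-Reasoning

lemma2p5 : (n z m r : ℕ) → n ≥ 1 → IsZ n z → IsM n m → IsR n r →
    yval n z m ≤ + 0 →
    (xval z m r ≤ - (+ r) - + 3) × (- (+ r) - + 3 ≤ - (+ 6))
lemma2p5 n z ℕ.zero r n≥1 _ isM _ _ with IsM⇒1≤m n≥1 isM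
... | ()
lemma2p5 n z (ℕ.suc k) r _ (3z<2n , _) (m²≤2n , _) (n≤2ʳ , r-min) y≤0 =
  xval-bound z (ℕ.suc k) r (exponent-inequality⇒x-bound 3z<2n key) ,
  3≤r⇒-r-3≤-6 (exponent-inequality⇒3≤r 3z<2n m²≤2n n≤2ʳ r-min key)
  where
  key : ExponentInequality n z k r
  key = 2ᴱ≤nᵏ⇒exponent-inequality n≤2ʳ (drop‿+≤+ (i-j≤0⇒i≤j y≤0))
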